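{- Let $G = \prod_{i=1}^t K[a_i,b_i]$, where $2 \leq b_1 \leq \cdots \leq b_t$. Then $$\mathrm{IR}(G) \leq \frac{b_1}{2b_1-1}\prod_{i=1}^t a_ib_i.$$
   Context: $K[a,b]$ is the balanced complete $b$-partite graph with $b$ parts each of size $a$ (two vertices adjacent iff in different parts). The direct product $\prod_i G_i$ has vertex set $\prod_i V(G_i)$, two tuples adjacent iff adjacent in every coordinate. A set $S$ of vertices is irredundant if every $v\in S$ has a private neighbor, i.e. a vertex in the closed neighborhood of $v$ not in the closed neighborhood of any vertex of $S\setminus\{v\}$. $\mathrm{IR}(G)$ is the maximum size of an irredundant set. -}

module Defs where

open import Data.Nat using (ℕ; _*_)
open import Data.Fin using (Fin)
open import Data.Product using (_×_; _,_; proj₁; proj₂; ∃)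
open import Data.Sum using (_⊎_)
open import Data.Unit using (⊤; tt)
open import Data.List using (List; []; _∷_; map)
open import Data.Nat.ListAction using (product)
open import Data.List.Membership.Propositional using (_∈_)
open import Relation.Binary.PropositionalEquality using (_≡_; _≢_)
open import Relation.Nullary using (¬_)

record Graph : Set₁ where
  field
    V   : Set
    Adj : V → V → Set
open Graph public

-- K[a,b]: balanced complete b-partite graph, b parts each of size a.
-- A vertex is (part, index within part); adjacent iff in different parts.
K : ℕ → ℕ → Graph
K a b = record { V = Fin b × Fin a ; Adj = λ x y → proj₁ x ≢ proj₁ y }

_⊗_ : Graph → Graph → Graph
G ⊗ H = record { V = V G × V H
               ; Adj = λ x y → Adj G (proj₁ x) (proj₁ y) × Adj H (proj₂ x) (proj₂ y) }

-- Product over a list; the empty product is the one-vertex graph with a loop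
-- (the unit for ⊗); it is never used by the theorem (t ≥ 1).
Prod : List Graph → Graph
Prod [] = record { V = ⊤ ; Adj = λ _ _ → ⊤ }
Prod (G ∷ Gs) = G ⊗ Prod Gs

ProdK : List (ℕ × ℕ) → Graph
ProdK ps = Prod (map (λ p → K (proj₁ p) (proj₂ p)) ps)

N[_]∋_ : {G : Graph} → V G → V G → Set
N[_]∋_ {G} v w = w ≡ v ⊎ Adj G v w

-- S (a duplicate-free list of vertices) is irredundant: every v ∈ S has a private
-- neighbour w ∈ N[v] with w ∉ N[u] for all u ∈ S, u ≠ v.
Irredundant : (G : Graph) → List (V G) → Set
Irredundant G S =
  ∀ {v} → v ∈ S →
    ∃ λ w → (N[_]∋_ {G} v w) × (∀ {u} → u ∈ S → u ≢ v → ¬ (N[_]∋_ {G} u w))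

orderK : List (ℕ × ℕ) → ℕ
orderK ps = product (map (λ p → proj₁ p * proj₂ p) ps)

-- We prove the stronger bound IR(G) ≤ |V(G)|/2, which implies the claim
-- because 2b₁ - 1 ≤ 2b₁.  The argument is a general fact about graphs:
--
--   If a finite symmetric graph G carries a pairing, i.e. an injective map
--   μ without fixed points such that v ~ μ v for every v, then every
--   irredundant set S satisfies 2|S| ≤ |V(G)|.
--
-- Each v ∈ S gets an outside partner: a private neighbour w ≠ v if it has
-- one, and μ v otherwise (then v is its own private neighbour, which forces
-- μ v ∉ S).  Partners lie outside S and distinct vertices of S get distinct
-- partners, so S together with its partners is a duplicate-free list of
-- 2|S| vertices; a pigeonhole count finishes the argument.
module Submission where

open import Defs
open import Data.Nat using (ℕ; _*_; _∸_; _≤_; _+_; suc; z≤n; s≤s)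
open import Data.Nat.Properties using (≤-trans; *-monoʳ-≤; m∸n≤m; *-comm; 1+n≢n; module ≤-Reasoning)
open import Data.Nat.Solver using (module +-*-Solver)
open import Data.Product using (_×_; _,_; proj₁; proj₂; Σ)
open import Data.Product.Properties using (≡-dec)
open import Data.Sum using (_⊎_; inj₁; inj₂)
open import Data.Empty using (⊥-elim)
open import Data.Unit using (tt)
open import Data.Fin using (Fin; zero; suc; fromℕ; inject₁; toℕ; _≟_)
open import Data.Fin.Properties using (fromℕ≢inject₁; inject₁-injective; toℕ-inject₁)
open import Data.List using (List; []; _∷_; map; length; _++_; allFin; cartesianProduct)
open import Data.List.Properties using (length-++; length-map; length-tabulate)
open import Data.List.Membership.Propositional using (_∈_; _∉_; mapWith∈)
open import Data.List.Membership.Propositional.Properties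
  using (∈-allFin; ∈-cartesianProduct⁺)
open import Data.List.Membership.Setoid.Properties using (length-mapWith∈)
open import Data.List.Relation.Unary.Any using (here; there)
open import Data.List.Relation.Unary.Any.Properties using (mapWith∈⁻)
open import Data.List.Relation.Unary.All as All using (All; []; _∷_)
open import Data.List.Relation.Unary.All.Properties using (map⁻)
open import Data.List.Relation.Unary.AllPairs using ([]; _∷_)
open import Data.List.Relation.Unary.Unique.Propositional using (Unique)
open import Data.List.Relation.Unary.Unique.Propositional.Properties using (++⁺)
open import Data.List.Relation.Unary.Linked using (Linked)
open import Data.List.Relation.Unary.Linked.Properties using (Linked⇒All)
open import Relation.Binary.Definitions using (DecidableEquality)
open import Relation.Binary.PropositionalEquality
  using (_≡_; _≢_; refl; sym; trans; cong; cong₂; subst; setoid; module ≡-Reasoning)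
open import Relation.Nullary using (¬_; yes; no)
open import Function using (id)

private
  variable
    A B : Set

delete : {x : A} (ys : List A) → x ∈ ys →
  Σ (List A) λ ys′ → length ys ≡ suc (length ys′) × (∀ {z} → z ∈ ys → z ≢ x → z ∈ ys′)
delete (y ∷ ys) (here refl) = ys , refl , keep
  where
    keep : ∀ {z} → z ∈ y ∷ ys → z ≢ y → z ∈ ys
    keep (here z≡y) z≢y = ⊥-elim (z≢y z≡y)
    keep (there z∈ys) _ = z∈ys
delete (y ∷ ys) (there x∈ys) with delete ys x∈ys
... | ys′ , len , keep = y ∷ ys′ , cong suc len , keep′
  where
    keep′ : ∀ {z} → z ∈ y ∷ ys → z ≢ _ → z ∈ y ∷ ys′
    keep′ (here z≡y) _ = here z≡y
    keep′ (there z∈ys) z≢x = there (keep z∈ys z≢x)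

unique-⊆⇒length-≤ : (xs ys : List A) → Unique xs → (∀ {z} → z ∈ xs → z ∈ ys) →
  length xs ≤ length ys
unique-⊆⇒length-≤ [] ys _ _ = z≤n
unique-⊆⇒length-≤ (x ∷ xs) ys (x∉xs ∷ uniq) xs⊆ys with delete ys (xs⊆ys (here refl))
... | ys′ , len , keep rewrite len =
  s≤s (unique-⊆⇒length-≤ xs ys′ uniq
         (λ z∈xs → keep (xs⊆ys (there z∈xs)) (λ { refl → All.lookup x∉xs z∈xs refl })))

mapWith∈-unique : (xs : List A) (f : ∀ {x} → x ∈ xs → B) → Unique xs →
  (∀ {x y} (p : x ∈ xs) (q : y ∈ xs) → x ≢ y → f p ≢ f q) → Unique (mapWith∈ xs f)
mapWith∈-unique [] f _ _ = []
mapWith∈-unique (x ∷ xs) f (x∉xs ∷ uniq) distinct =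
  All.tabulate head-fresh
    ∷ mapWith∈-unique xs (λ p → f (there p)) uniq (λ p q → distinct (there p) (there q))
  where
    head-fresh : ∀ {z} → z ∈ mapWith∈ xs (λ p → f (there p)) → f (here refl) ≢ z
    head-fresh z∈ with mapWith∈⁻ xs (λ p → f (there p)) z∈
    ... | y , y∈xs , z≡fy = λ fx≡z →
      distinct (here refl) (there y∈xs) (All.lookup x∉xs y∈xs) (trans fx≡z z≡fy)

Private : (G : Graph) → List (V G) → V G → V G → Set
Private G S v w = ∀ {u} → u ∈ S → u ≢ v → ¬ (N[_]∋_ {G} u w)

record Pairing (G : Graph) : Set where
  field
    mate           : V G → V G
    mate-injective : ∀ {x y} → mate x ≡ mate y → x ≡ y
    mate-adjacent  : ∀ x → Adj G x (mate x)
    mate-moves     : ∀ x → mate x ≢ x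

module HalfBound (G : Graph) (_≟ᵥ_ : DecidableEquality (V G))
                 (adj-sym : ∀ {x y} → Adj G x y → Adj G y x) (P : Pairing G)
                 (S : List (V G)) (irr : Irredundant G S) where
  open Pairing P

  record Partner (v : V G) : Set where
    field
      vertex    : V G
      adjacent  : Adj G v vertex
      outside   : vertex ∉ S
      canonical : vertex ≡ mate v ⊎ Private G S v vertex

  -- A vertex that is its own private neighbour has its mate outside S,
  -- since v lies in the closed neighbourhood of its mate.
  mate-outside : ∀ {v} → Private G S v v → mate v ∉ S
  mate-outside {v} priv mate∈S = priv mate∈S (mate-moves v) (inj₂ (adj-sym (mate-adjacent v)))

  partner : ∀ {v} → v ∈ S → Partner v
  partner {v} v∈S with irr v∈S
  ... | w , w∈N[v] , priv with w ≟ᵥ v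
  ...   | yes refl = record { vertex = mate v ; adjacent = mate-adjacent v
                            ; outside = mate-outside priv ; canonical = inj₁ refl }
  ...   | no w≢v = record { vertex = w ; adjacent = proper w∈N[v]
                          ; outside = λ w∈S → priv w∈S w≢v (inj₁ refl) ; canonical = inj₂ priv }
    where
      proper : N[_]∋_ {G} v w → Adj G v w
      proper (inj₁ w≡v) = ⊥-elim (w≢v w≡v)
      proper (inj₂ v~w) = v~w

  partner-vertex : ∀ {v} → v ∈ S → V G
  partner-vertex v∈S = Partner.vertex (partner v∈S)

  -- Distinct members of S have distinct partners: a shared partner cannot be
  -- private to one of them (it is adjacent to the other), so both are mates.
  partners-distinct : ∀ {x y} (p : x ∈ S) (q : y ∈ S) → x ≢ y →
    partner-vertex p ≢ partner-vertex q
  partners-distinct {x} {y} p q x≢y shared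
    with Partner.canonical (partner p) | Partner.canonical (partner q)
  ... | _ | inj₂ priv-y =
    priv-y p x≢y (inj₂ (subst (Adj G x) shared (Partner.adjacent (partner p))))
  ... | inj₂ priv-x | _ =
    priv-x q (λ y≡x → x≢y (sym y≡x)) (inj₂ (subst (Adj G y) (sym shared) (Partner.adjacent (partner q))))
  ... | inj₁ e₁ | inj₁ e₂ = x≢y (mate-injective (trans (sym e₁) (trans shared e₂)))

  doubled : List (V G)
  doubled = S ++ mapWith∈ S partner-vertex

  doubled-unique : Unique S → Unique doubled
  doubled-unique uniq =
    ++⁺ uniq (mapWith∈-unique S partner-vertex uniq partners-distinct) disjoint
    where
      disjoint : ∀ {z} → ¬ (z ∈ S × z ∈ mapWith∈ S partner-vertex)
      disjoint (z∈S , z∈partners) with mapWith∈⁻ S partner-vertex z∈partners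
      ... | v , v∈S , refl = Partner.outside (partner v∈S) z∈S

  length-doubled : length doubled ≡ length S + length S
  length-doubled = trans (length-++ S) (cong (length S +_) (length-mapWith∈ (setoid _) S))

irredundant-half : (G : Graph) → DecidableEquality (V G) →
  (∀ {x y} → Adj G x y → Adj G y x) → Pairing G →
  (vs : List (V G)) → (∀ x → x ∈ vs) →
  (S : List (V G)) → Unique S → Irredundant G S → length S + length S ≤ length vs
irredundant-half G _≟ᵥ_ adj-sym P vs complete S uniq irr =
  subst (_≤ length vs) length-doubled
    (unique-⊆⇒length-≤ doubled vs (doubled-unique uniq) (λ {z} _ → complete z))
  where open HalfBound G _≟ᵥ_ adj-sym P S irr

Vertex : List (ℕ × ℕ) → Set
Vertex ps = V (ProdK ps)

vertex-≟ : ∀ ps → DecidableEquality (Vertex ps)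
vertex-≟ []       tt tt = yes refl
vertex-≟ (_ ∷ ps) = ≡-dec (≡-dec _≟_ _≟_) (vertex-≟ ps)

adj-symmetric : ∀ ps {x y : Vertex ps} → Adj (ProdK ps) x y → Adj (ProdK ps) y x
adj-symmetric []       tt          = tt
adj-symmetric (_ ∷ ps) (x≢y , x~y) = (λ y≡x → x≢y (sym y≡x)) , adj-symmetric ps x~y

adj-irreflexive : ∀ p ps {x : Vertex (p ∷ ps)} → ¬ Adj (ProdK (p ∷ ps)) x x
adj-irreflexive _ _ (x≢x , _) = x≢x refl

rotate : ∀ {n} → Fin n → Fin n
rotate {suc n} zero    = fromℕ n
rotate {suc n} (suc i) = inject₁ i

rotate-injective : ∀ {n} {i j : Fin n} → rotate i ≡ rotate j → i ≡ j
rotate-injective {i = zero}  {zero}  _ = refl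
rotate-injective {i = zero}  {suc j} e = ⊥-elim (fromℕ≢inject₁ e)
rotate-injective {i = suc i} {zero}  e = ⊥-elim (fromℕ≢inject₁ (sym e))
rotate-injective {i = suc i} {suc j} e = cong suc (inject₁-injective e)

rotate-moves : ∀ {n} → 2 ≤ n → (i : Fin n) → rotate i ≢ i
rotate-moves {1} (s≤s ()) _
rotate-moves {suc (suc n)} _ zero ()
rotate-moves {suc (suc n)} _ (suc i) e = 1+n≢n (sym (trans (sym (toℕ-inject₁ i)) (cong toℕ e)))

shift : ∀ ps → Vertex ps → Vertex ps
shift []       tt             = tt
shift (_ ∷ ps) ((i , k) , r) = (rotate i , k) , shift ps r

shift-injective : ∀ ps {x y : Vertex ps} → shift ps x ≡ shift ps y → x ≡ y
shift-injective []       {tt} {tt} _ = refl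
shift-injective (_ ∷ ps) {(i , k) , r} {(j , l) , s} e
  with rotate-injective (cong (λ z → proj₁ (proj₁ z)) e) | cong (λ z → proj₂ (proj₁ z)) e
     | shift-injective ps (cong proj₂ e)
... | refl | refl | refl = refl

-- When all bᵢ ≥ 2 every vertex is adjacent to its shift: every part index moves.
shift-adjacent : ∀ ps → All (λ p → 2 ≤ proj₂ p) ps → ∀ x → Adj (ProdK ps) x (shift ps x)
shift-adjacent []       []         tt             = tt
shift-adjacent (_ ∷ ps) (2≤b ∷ hs) ((i , k) , r) =
  (λ i≡rot → rotate-moves 2≤b i (sym i≡rot)) , shift-adjacent ps hs r

pairing : ∀ p ps → All (λ q → 2 ≤ proj₂ q) (p ∷ ps) → Pairing (ProdK (p ∷ ps))
pairing p ps hs = record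
  { mate           = shift (p ∷ ps)
  ; mate-injective = shift-injective (p ∷ ps)
  ; mate-adjacent  = shift-adjacent (p ∷ ps) hs
  ; mate-moves     = λ x shift≡x → adj-irreflexive p ps {x}
      (subst (Adj (ProdK (p ∷ ps)) x) shift≡x (shift-adjacent (p ∷ ps) hs x))
  }

length-cartesianProduct : (xs : List A) (ys : List B) →
  length (cartesianProduct xs ys) ≡ length xs * length ys
length-cartesianProduct []       ys = refl
length-cartesianProduct (x ∷ xs) ys =
  trans (length-++ (map (x ,_) ys)) (cong₂ _+_ (length-map (x ,_) ys) (length-cartesianProduct xs ys))

vertices : ∀ ps → List (Vertex ps)
vertices []             = tt ∷ []
vertices ((a , b) ∷ ps) = cartesianProduct (cartesianProduct (allFin b) (allFin a)) (vertices ps)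

vertices-complete : ∀ ps (x : Vertex ps) → x ∈ vertices ps
vertices-complete []             tt            = here refl
vertices-complete ((a , b) ∷ ps) ((i , k) , r) =
  ∈-cartesianProduct⁺ (∈-cartesianProduct⁺ (∈-allFin i) (∈-allFin k)) (vertices-complete ps r)

length-vertices : ∀ ps → length (vertices ps) ≡ orderK ps
length-vertices []             = refl
length-vertices ((a , b) ∷ ps) = begin
  length (vertices ((a , b) ∷ ps))
    ≡⟨ length-cartesianProduct (cartesianProduct (allFin b) (allFin a)) (vertices ps) ⟩
  length (cartesianProduct (allFin b) (allFin a)) * length (vertices ps)
    ≡⟨ cong₂ _*_ (length-cartesianProduct (allFin b) (allFin a)) (length-vertices ps) ⟩
  length (allFin b) * length (allFin a) * orderK ps
    ≡⟨ cong (_* orderK ps) (cong₂ _*_ (length-tabulate {n = b} id) (length-tabulate {n = a} id)) ⟩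
  b * a * orderK ps
    ≡⟨ cong (_* orderK ps) (*-comm b a) ⟩
  a * b * orderK ps ∎
  where open ≡-Reasoning

half⇒bound : ∀ s b n → s + s ≤ n → s * (2 * b ∸ 1) ≤ b * n
half⇒bound s b n 2s≤n = begin
  s * (2 * b ∸ 1) ≤⟨ *-monoʳ-≤ s (m∸n≤m (2 * b) 1) ⟩
  s * (2 * b)     ≡⟨ solve 2 (λ s b → s :* (con 2 :* b) := b :* (s :+ s)) refl s b ⟩
  b * (s + s)     ≤⟨ *-monoʳ-≤ b 2s≤n ⟩
  b * n           ∎
  where open ≤-Reasoning
        open +-*-Solver

theorem5p8 : (a₁ b₁ : ℕ) (rest : List (ℕ × ℕ)) →
    2 ≤ b₁ →
    Linked _≤_ (map proj₂ ((a₁ , b₁) ∷ rest)) →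
    (S : List (V (ProdK ((a₁ , b₁) ∷ rest)))) →
    Unique S →
    Irredundant (ProdK ((a₁ , b₁) ∷ rest)) S →
    length S * (2 * b₁ ∸ 1) ≤ b₁ * orderK ((a₁ , b₁) ∷ rest)
theorem5p8 a₁ b₁ rest h2 lk S uS ir =
  half⇒bound (length S) b₁ (orderK ps)
    (subst (length S + length S ≤_) (length-vertices ps)
      (irredundant-half (ProdK ps) (vertex-≟ ps) (λ {x} {y} → adj-symmetric ps {x} {y})
         (pairing (a₁ , b₁) rest all-b≥2) (vertices ps) (vertices-complete ps) S uS ir))
  where
    ps : List (ℕ × ℕ)
    ps = (a₁ , b₁) ∷ rest
    -- b₁ ≤ b₂ ≤ ⋯ ≤ b_t and 2 ≤ b₁ give 2 ≤ bᵢ for every i.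
    all-b≥2 : All (λ p → 2 ≤ proj₂ p) ps
    all-b≥2 = map⁻ (Linked⇒All ≤-trans h2 lk)
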